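{- Let $q\in\mathbb{C}$ be such that $[n]_q\neq 0$ for all $n\geq 1$, let $u,\alpha\in\mathbb{C}$, and let $(a_n^{(\alpha)})_{n\ge0}$ be complex numbers with $a_0^{(\alpha)}\neq0$, $(\mathcal{A}_q(t))^{\alpha}=\sum_{n\ge0}a_n^{(\alpha)}\frac{t^n}{[n]_q!}$. Let $\mathrm{P}_{n,q}^{(\alpha)}(x)$ be defined by $(\mathcal{A}_q(t))^{\alpha}\mathrm{e}_q(tx)=\sum_{n\ge0}\mathrm{P}_{n,q}^{(\alpha)}(x)\frac{t^n}{[n]_q!}$ and $\mathrm{P}_{n,q}^{(\alpha)}(x,y;u)$ by $(\mathcal{A}_q(t))^{\alpha}\mathrm{e}_q(tx)\mathrm{e}_q(ty,u)=\sum_{n\ge0}\mathrm{P}_{n,q}^{(\alpha)}(x,y;u)\frac{t^n}{[n]_q!}$. Let $\mathrm{T}(yD_q|u)$ be the linear operator on polynomials in $x$ (with coefficients depending on $y$) determined by $\mathrm{T}(yD_q|u)\{x^n\}=\mathrm{R}_n(x,y;u|q)$ for all $n\ge0$. Then for all $n\ge0$, $$\mathrm{P}_{n,q}^{(\alpha)}(x,y;u)=\mathrm{T}(yD_q|u)\{\mathrm{P}_{n,q}^{(\alpha)}(x)\}.$$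
   Context: $[n]_q=\frac{1-q^n}{1-q}$, $[n]_q!=[1]_q\cdots[n]_q$ ($[0]_q!=1$). $\mathrm{e}_q(z,u)=\sum_{n\ge0}u^{\binom{n}{2}}\frac{z^n}{[n]_q!}$ (convention $0^0=1$), $\mathrm{e}_q(z)=\mathrm{e}_q(z,1)$. The deformed homogeneous polynomials $\mathrm{R}_n(x,y;u|q)$ are defined by $\mathrm{e}_q(tx)\mathrm{e}_q(ty,u)=\sum_{n\ge0}\mathrm{R}_n(x,y;u|q)\frac{t^n}{[n]_q!}$, i.e. $\mathrm{R}_n(x,y;u|q)=\sum_{k=0}^n\frac{[n]_q!}{[k]_q![n-k]_q!}u^{\binom{k}{2}}y^kx^{n-k}$. Identities are of formal power series in $t$. -}

module Defs where

open import Level using (Level; _⊔_)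
open import Data.Nat as ℕ using (ℕ; zero; suc; _∸_; _≤?_)
open import Data.Bool using (if_then_else_)
open import Relation.Nullary using (¬_; does)
open import Algebra.Bundles using (CommutativeRing)

-- A field presented as a commutative ring with a total inversion map
-- (the value of 0⁻¹ is irrelevant) satisfying x ≉ 0 → x * x⁻¹ ≈ 1, and 1 ≉ 0.
-- Stands in for ℂ (which is absent from agda-stdlib).
record Field (c ℓ : Level) : Set (Level.suc (c ⊔ ℓ)) where
  field
    commRing : CommutativeRing c ℓ
  open CommutativeRing commRing public
  field
    _⁻¹     : Carrier → Carrier
    inverse : ∀ x → ¬ (x ≈ 0#) → x * (x ⁻¹) ≈ 1#
    1≉0     : ¬ (1# ≈ 0#)

choose2 : ℕ → ℕ
choose2 zero    = 0
choose2 (suc n) = n ℕ.+ choose2 n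

module _ {c ℓ : Level} (K : Field c ℓ) where
  open Field K

  sumTo : ℕ → (ℕ → Carrier) → Carrier
  sumTo zero    f = 0#
  sumTo (suc n) f = sumTo n f + f n

  pow : Carrier → ℕ → Carrier
  pow z zero    = 1#
  pow z (suc n) = pow z n * z

  qnum : Carrier → ℕ → Carrier
  qnum q n = sumTo n (pow q)

  qfact : Carrier → ℕ → Carrier
  qfact q zero    = 1#
  qfact q (suc n) = qfact q n * qnum q (suc n)

  qinvfact : Carrier → ℕ → Carrier
  qinvfact q n = (qfact q n) ⁻¹

  -- q-binomial [n]_q! / ([k]_q! [n-k]_q!)   (used for k ≤ n)
  qbin : Carrier → ℕ → ℕ → Carrier
  qbin q n k = qfact q n * (qinvfact q k * qinvfact q (n ∸ k))

  -- Polynomials in x are coefficient functions ℕ → Carrier (coefficient of x^j).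
  -- Coefficient of x^j in R_m(x,y;u|q) = Σ_k qbin(m,k) u^{C(k,2)} y^k x^{m-k}:
  Rcoef : (q u y : Carrier) → ℕ → ℕ → Carrier
  Rcoef q u y m j =
    if does (j ≤? m)
    then qbin q m (m ∸ j) * (pow u (choose2 (m ∸ j)) * pow y (m ∸ j))
    else 0#

  -- T(yD_q|u) applied to a polynomial p of degree ≤ d (coefficients p 0 .. p d),
  -- by linearity from T{x^m} = R_m(x,y;u|q); result as coefficient function in x.
  Tapp : (q u y : Carrier) → ℕ → (ℕ → Carrier) → ℕ → Carrier
  Tapp q u y d p j = sumTo (suc d) (λ m → p m * Rcoef q u y m j)

  -- Formal power series in t whose coefficients are polynomials in x:
  -- F n j = coefficient of t^n x^j.
  BSer : Set c
  BSer = ℕ → ℕ → Carrier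

  bmul : BSer → BSer → BSer
  bmul F G n j = sumTo (suc n) (λ i → sumTo (suc j) (λ k → F i k * G (n ∸ i) (j ∸ k)))

  δ : ℕ → ℕ → Carrier
  δ zero    zero    = 1#
  δ zero    (suc _) = 0#
  δ (suc _) zero    = 0#
  δ (suc m) (suc n) = δ m n

  Aser : Carrier → (ℕ → Carrier) → BSer
  Aser q a n j = δ j 0 * (a n * qinvfact q n)

  eqX : Carrier → BSer
  eqX q n j = δ n j * qinvfact q n

  eqY : (q u y : Carrier) → BSer
  eqY q u y n j = δ j 0 * (pow u (choose2 n) * (pow y n * qinvfact q n))

  genSer : Carrier → (ℕ → ℕ → Carrier) → BSer
  genSer q P n j = P n j * qinvfact q n

{-# OPTIONS --safe #-}
-- T is linear and A_q(t)^α does not involve x, so T{A_q(t)^α e_q(tx)} = A_q(t)^α T{e_q(tx)},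
-- while T{e_q(tx)} = Σ R_n(x,y;u|q) tⁿ/[n]_q! = e_q(tx) e_q(ty,u) by the definition of R_n.
-- Concretely, with α_k = a_k/[k]_q!, both sides of the tⁿxʲ coefficient (j ≤ n) reduce to the
-- convolution Σ_{t ≤ n-j} α_{n-j-t} · 1/[j]_q! · u^(t choose 2) yᵗ/[t]_q!. The hypothesis
-- [n]_q ≠ 0 makes every [m]_q! invertible, which is needed to read P off its generating series
-- and to cancel [m]_q! against the q-binomial coefficients inside R_m.
module Submission where

open import Defs
open import Level using (Level)
open import Data.Nat as ℕ using (ℕ; zero; suc; _∸_; _≤_; _<_; _≤?_; z≤n; s≤s)
open import Data.Nat.Properties
  using (n<1+n; m<n⇒m<1+n; ≤-pred; <⇒≢; <⇒≱; ≰⇒>; ≤∧≢⇒<; ≤-<-trans; m∸n≤m; m≤m+n;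
         +-monoʳ-≤; m+n∸m≡n; m∸n+n≡m; m+[n∸m]≡n; m∸[m∸n]≡n; ∸-+-assoc; n∸n≡0; m>n⇒m∸n≢0)
import Data.Nat.Properties as ℕₚ
open import Data.Empty using (⊥-elim)
open import Function using (_∘_)
open import Data.Bool using (if_then_else_)
open import Relation.Nullary using (¬_; yes; no)
open import Relation.Nullary.Decidable using (dec-true; dec-false)
open import Relation.Binary.PropositionalEquality as ≡ using (_≡_; _≢_)

module _ {c ℓ : Level} (K : Field c ℓ) where
  open Field K
  open import Relation.Binary.Reasoning.Setoid setoid
  open import Algebra.Solver.CommutativeMonoid *-commutativeMonoid
    using (solve; _⊜_) renaming (_⊕_ to _·_)

  *-inverse-cancelʳ : ∀ {x} → ¬ (x ≈ 0#) → ∀ y → y * x ⁻¹ * x ≈ y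
  *-inverse-cancelʳ {x} x≉0 y = begin
    y * x ⁻¹ * x    ≈⟨ solve 3 (λ y x x' → (y · x') · x ⊜ y · (x · x')) refl y x (x ⁻¹) ⟩
    y * (x * x ⁻¹)  ≈⟨ *-congˡ (inverse x x≉0) ⟩
    y * 1#          ≈⟨ *-identityʳ y ⟩
    y               ∎

  *-nonzero : ∀ {x y} → ¬ (x ≈ 0#) → ¬ (y ≈ 0#) → ¬ (x * y ≈ 0#)
  *-nonzero {x} {y} x≉0 y≉0 xy≈0 = y≉0 (begin
    y                 ≈⟨ sym (*-inverse-cancelʳ x≉0 y) ⟩
    y * x ⁻¹ * x      ≈⟨ solve 3 (λ y x x' → (y · x') · x ⊜ x' · (x · y)) refl y x (x ⁻¹) ⟩
    x ⁻¹ * (x * y)    ≈⟨ *-congˡ xy≈0 ⟩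
    x ⁻¹ * 0#         ≈⟨ zeroʳ _ ⟩
    0#                ∎)

  sumTo-cong : ∀ n {f g : ℕ → Carrier} → (∀ i → i < n → f i ≈ g i) → sumTo K n f ≈ sumTo K n g
  sumTo-cong zero    f≈g = refl
  sumTo-cong (suc n) f≈g = +-cong (sumTo-cong n (λ i i<n → f≈g i (m<n⇒m<1+n i<n))) (f≈g n (n<1+n n))

  sumTo-zero : ∀ n {f : ℕ → Carrier} → (∀ i → i < n → f i ≈ 0#) → sumTo K n f ≈ 0#
  sumTo-zero zero    f≈0 = refl
  sumTo-zero (suc n) f≈0 =
    trans (+-cong (sumTo-zero n (λ i i<n → f≈0 i (m<n⇒m<1+n i<n))) (f≈0 n (n<1+n n))) (+-identityʳ 0#)

  sumTo-single : ∀ n {f : ℕ → Carrier} k → k < n → (∀ i → i < n → i ≢ k → f i ≈ 0#) →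
                 sumTo K n f ≈ f k
  sumTo-single (suc n) k k<1+n others with k ℕ.≟ n
  ... | yes ≡.refl = trans (+-congʳ (sumTo-zero n (λ i i<n → others i (m<n⇒m<1+n i<n) (<⇒≢ i<n))))
                           (+-identityˡ _)
  ... | no k≢n = trans (+-cong (sumTo-single n k (≤∧≢⇒< (≤-pred k<1+n) k≢n)
                                  (λ i i<n → others i (m<n⇒m<1+n i<n)))
                               (others n (n<1+n n) (k≢n ∘ ≡.sym)))
                       (+-identityʳ _)

  *-distribˡ-sumTo : ∀ x n (f : ℕ → Carrier) → x * sumTo K n f ≈ sumTo K n (λ i → x * f i)
  *-distribˡ-sumTo x zero    f = zeroʳ x
  *-distribˡ-sumTo x (suc n) f = trans (distribˡ x _ _) (+-congʳ (*-distribˡ-sumTo x n f))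

  sumTo-shift : ∀ n m {f : ℕ → Carrier} → (∀ i → i < m → f i ≈ 0#) →
                sumTo K (n ℕ.+ m) f ≈ sumTo K n (λ i → f (m ℕ.+ i))
  sumTo-shift zero    m f≈0 = sumTo-zero m f≈0
  sumTo-shift (suc n) m {f} f≈0 =
    +-cong (sumTo-shift n m f≈0) (reflexive (≡.cong f (ℕₚ.+-comm n m)))

  sumTo-from : ∀ {n j} → j ≤ n → (f : ℕ → Carrier) → (∀ i → i < j → f i ≈ 0#) →
               sumTo K (suc n) f ≈ sumTo K (suc (n ∸ j)) (λ t → f (j ℕ.+ t))
  sumTo-from {n} {j} j≤n f f≈0 = begin
    sumTo K (suc n) f                         ≡⟨ ≡.cong (λ k → sumTo K (suc k) f) (≡.sym (m∸n+n≡m j≤n)) ⟩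
    sumTo K (suc (n ∸ j) ℕ.+ j) f             ≈⟨ sumTo-shift (suc (n ∸ j)) j f≈0 ⟩
    sumTo K (suc (n ∸ j)) (λ t → f (j ℕ.+ t)) ∎

  sumTo-suc : ∀ n (f : ℕ → Carrier) → sumTo K (suc n) f ≈ f 0 + sumTo K n (λ i → f (suc i))
  sumTo-suc zero    f = trans (+-identityˡ _) (sym (+-identityʳ _))
  sumTo-suc (suc n) f = trans (+-congʳ (sumTo-suc n f)) (+-assoc _ _ _)

  sumTo-reverse : ∀ n (f : ℕ → Carrier) → sumTo K (suc n) f ≈ sumTo K (suc n) (λ i → f (n ∸ i))
  sumTo-reverse zero    f = refl
  sumTo-reverse (suc n) f = begin
    sumTo K (suc n) f + f (suc n)                      ≈⟨ +-congʳ (sumTo-reverse n f) ⟩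
    sumTo K (suc n) (λ i → f (n ∸ i)) + f (suc n)      ≈⟨ +-comm _ _ ⟩
    f (suc n) + sumTo K (suc n) (λ i → f (n ∸ i))      ≈⟨ sym (sumTo-suc (suc n) (λ i → f (suc n ∸ i))) ⟩
    sumTo K (suc (suc n)) (λ i → f (suc n ∸ i))        ∎

  δ-refl : ∀ m → δ K m m ≈ 1#
  δ-refl zero    = refl
  δ-refl (suc m) = δ-refl m

  δ-≢ : ∀ {m n} → m ≢ n → δ K m n ≈ 0#
  δ-≢ {zero}  {zero}  0≢0 = ⊥-elim (0≢0 ≡.refl)
  δ-≢ {zero}  {suc n} _   = refl
  δ-≢ {suc m} {zero}  _   = refl
  δ-≢ {suc m} {suc n} m≢n = δ-≢ (λ m≡n → m≢n (≡.cong suc m≡n))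

  -- Aser q a and eqY q u y are definitionally of this form.
  constSer : (ℕ → Carrier) → BSer K
  constSer α n j = δ K j 0 * α n

  bmul-constSerˡ : ∀ α (G : BSer K) n j →
                   bmul K (constSer α) G n j ≈ sumTo K (suc n) (λ i → α i * G (n ∸ i) j)
  bmul-constSerˡ α G n j = sumTo-cong (suc n) λ i _ →
    trans (sumTo-single (suc j) 0 (s≤s z≤n) λ k _ k≢0 →
             trans (*-congʳ (trans (*-congʳ (δ-≢ k≢0)) (zeroˡ _))) (zeroˡ _))
          (*-congʳ (*-identityˡ (α i)))

  bmul-constSerʳ : ∀ (F : BSer K) β n j →
                   bmul K F (constSer β) n j ≈ sumTo K (suc n) (λ i → F i j * β (n ∸ i))
  bmul-constSerʳ F β n j = sumTo-cong (suc n) λ i _ →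
    trans (sumTo-single (suc j) j (n<1+n j) λ k k<1+j k≢j →
             trans (*-congˡ (trans (*-congʳ (δ-≢ (m>n⇒m∸n≢0 (≤∧≢⇒< (≤-pred k<1+j) k≢j)))) (zeroˡ _)))
                   (zeroʳ _))
          (*-congˡ (trans (*-congʳ (reflexive (≡.cong (λ r → δ K r 0) (n∸n≡0 j)))) (*-identityˡ _)))

  module _ (q : Carrier) (α : ℕ → Carrier) where

    bmul-constSer-eqX-≤ : ∀ {n m} → m ≤ n →
                          bmul K (constSer α) (eqX K q) n m ≈ α (n ∸ m) * qinvfact K q m
    bmul-constSer-eqX-≤ {n} {m} m≤n = begin
      bmul K (constSer α) (eqX K q) n m
        ≈⟨ bmul-constSerˡ α (eqX K q) n m ⟩
      sumTo K (suc n) (λ i → α i * (δ K (n ∸ i) m * qinvfact K q (n ∸ i)))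
        ≈⟨ sumTo-single (suc n) (n ∸ m) (s≤s (m∸n≤m n m)) off-diagonal ⟩
      α (n ∸ m) * (δ K (n ∸ (n ∸ m)) m * qinvfact K q (n ∸ (n ∸ m)))
        ≡⟨ ≡.cong (λ r → α (n ∸ m) * (δ K r m * qinvfact K q r)) (m∸[m∸n]≡n m≤n) ⟩
      α (n ∸ m) * (δ K m m * qinvfact K q m)
        ≈⟨ *-congˡ (trans (*-congʳ (δ-refl m)) (*-identityˡ _)) ⟩
      α (n ∸ m) * qinvfact K q m ∎
      where
      off-diagonal : ∀ i → i < suc n → i ≢ n ∸ m →
                     α i * (δ K (n ∸ i) m * qinvfact K q (n ∸ i)) ≈ 0#
      off-diagonal i i<1+n i≢n∸m =
        trans (*-congˡ (trans (*-congʳ (δ-≢ n∸i≢m)) (zeroˡ _))) (zeroʳ _)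
        where
        n∸i≢m : n ∸ i ≢ m
        n∸i≢m n∸i≡m = i≢n∸m (≡.trans (≡.sym (m∸[m∸n]≡n (≤-pred i<1+n))) (≡.cong (n ∸_) n∸i≡m))

    bmul-constSer-eqX-> : ∀ {n m} → n < m → bmul K (constSer α) (eqX K q) n m ≈ 0#
    bmul-constSer-eqX-> {n} {m} n<m =
      trans (bmul-constSerˡ α (eqX K q) n m)
            (sumTo-zero (suc n) λ i _ →
               trans (*-congˡ (trans (*-congʳ (δ-≢ (<⇒≢ (≤-<-trans (m∸n≤m n i) n<m)))) (zeroˡ _)))
                     (zeroʳ _))

  module _ (q u y : Carrier) where

    eqYcoeff : ℕ → Carrier
    eqYcoeff r = pow K u (choose2 r) * (pow K y r * qinvfact K q r)

    Rterm : ℕ → ℕ → Carrier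
    Rterm m k = qbin K q m k * (pow K u (choose2 k) * pow K y k)

    Rcoef-≤ : ∀ {m j} → j ≤ m → Rcoef K q u y m j ≡ Rterm m (m ∸ j)
    Rcoef-≤ {m} {j} j≤m =
      ≡.cong (λ b → if b then Rterm m (m ∸ j) else 0#) (dec-true (j ≤? m) j≤m)

    Rcoef-> : ∀ {m j} → m < j → Rcoef K q u y m j ≡ 0#
    Rcoef-> {m} {j} m<j =
      ≡.cong (λ b → if b then Rterm m (m ∸ j) else 0#) (dec-false (j ≤? m) (<⇒≱ m<j))

  module _ (q u y : Carrier) (d : ℕ) where

    Tapp-cong : ∀ {p p′ : ℕ → Carrier} → (∀ m → p m ≈ p′ m) →
                ∀ j → Tapp K q u y d p j ≈ Tapp K q u y d p′ j
    Tapp-cong p≈p′ j = sumTo-cong (suc d) (λ m _ → *-congʳ (p≈p′ m))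

    *-distribˡ-Tapp : ∀ x p j → x * Tapp K q u y d p j ≈ Tapp K q u y d (λ m → x * p m) j
    *-distribˡ-Tapp x p j =
      trans (*-distribˡ-sumTo x (suc d) _) (sumTo-cong (suc d) (λ m _ → sym (*-assoc _ _ _)))

  module _ (q : Carrier) (hq : ∀ (n : ℕ) → 1 ≤ n → ¬ (qnum K q n ≈ 0#)) where

    qfact-nonzero : ∀ n → ¬ (qfact K q n ≈ 0#)
    qfact-nonzero zero    = 1≉0
    qfact-nonzero (suc n) = *-nonzero (qfact-nonzero n) (hq (suc n) (s≤s z≤n))

    qinvfact-*-qbin : ∀ m k → qinvfact K q m * qbin K q m k ≈ qinvfact K q k * qinvfact K q (m ∸ k)
    qinvfact-*-qbin m k = begin
      I m * (F m * (I k * I (m ∸ k)))    ≈⟨ solve 3 (λ i f x → i · (f · x) ⊜ (f · i) · x) refl (I m) (F m) _ ⟩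
      (F m * I m) * (I k * I (m ∸ k))    ≈⟨ *-congʳ (inverse (F m) (qfact-nonzero m)) ⟩
      1# * (I k * I (m ∸ k))             ≈⟨ *-identityˡ _ ⟩
      I k * I (m ∸ k)                    ∎
      where
      F I : ℕ → Carrier
      F = qfact K q
      I = qinvfact K q

    genSer-coefficient : ∀ {G : BSer K} {P : ℕ → ℕ → Carrier} →
                         (∀ n j → G n j ≈ genSer K q P n j) → ∀ n j → P n j ≈ qfact K q n * G n j
    genSer-coefficient {G} {P} G≈P n j = begin
      P n j                                       ≈⟨ sym (*-inverse-cancelʳ (qfact-nonzero n) (P n j)) ⟩
      P n j * qinvfact K q n * qfact K q n        ≈⟨ *-comm _ _ ⟩
      qfact K q n * (P n j * qinvfact K q n)      ≈⟨ *-congˡ (sym (G≈P n j)) ⟩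
      qfact K q n * G n j                         ∎

    -- Coefficientwise form of Σ R_m(x,y;u|q) tᵐ/[m]_q! = e_q(tx) e_q(ty,u).
    qinvfact-*-Rcoef : ∀ u y {m j} → j ≤ m →
                       qinvfact K q m * Rcoef K q u y m j ≈ qinvfact K q j * eqYcoeff q u y (m ∸ j)
    qinvfact-*-Rcoef u y {m} {j} j≤m = begin
      I m * Rcoef K q u y m j       ≡⟨ ≡.cong (I m *_) (Rcoef-≤ q u y j≤m) ⟩
      I m * (qbin K q m k * (U * Y)) ≈⟨ sym (*-assoc _ _ _) ⟩
      (I m * qbin K q m k) * (U * Y) ≈⟨ *-congʳ (qinvfact-*-qbin m k) ⟩
      (I k * I (m ∸ k)) * (U * Y)   ≡⟨ ≡.cong (λ r → (I k * I r) * (U * Y)) (m∸[m∸n]≡n j≤m) ⟩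
      (I k * I j) * (U * Y)         ≈⟨ solve 4 (λ ik ij U Y → (ik · ij) · (U · Y) ⊜ ij · (U · (Y · ik)))
                                             refl (I k) (I j) U Y ⟩
      I j * (U * (Y * I k))         ∎
      where
      I : ℕ → Carrier
      I = qinvfact K q
      k : ℕ
      k = m ∸ j
      U Y : Carrier
      U = pow K u (choose2 k)
      Y = pow K y k

  module _ (q u y : Carrier) (α : ℕ → Carrier) where

    private
      B : BSer K
      B = bmul K (constSer α) (eqX K q)
      E : ℕ → Carrier
      E = eqYcoeff q u y
      I : ℕ → Carrier
      I = qinvfact K q

    bmul-eqY-convolution : ∀ {n j} → j ≤ n →
                 bmul K B (eqY K q u y) n j ≈ sumTo K (suc (n ∸ j)) (λ t → α (n ∸ j ∸ t) * (I j * E t))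
    bmul-eqY-convolution {n} {j} j≤n = begin
      bmul K B (eqY K q u y) n j
        ≈⟨ bmul-constSerʳ B E n j ⟩
      sumTo K (suc n) (λ i → B i j * E (n ∸ i))
        ≈⟨ sumTo-from j≤n _ (λ i i<j → trans (*-congʳ (bmul-constSer-eqX-> q α i<j)) (zeroˡ _)) ⟩
      sumTo K (suc M) (λ t → B (j ℕ.+ t) j * E (n ∸ (j ℕ.+ t)))
        ≈⟨ sumTo-cong (suc M) (λ t _ → shifted t) ⟩
      sumTo K (suc M) (λ t → α t * (I j * E (M ∸ t)))
        ≈⟨ sumTo-reverse M _ ⟩
      sumTo K (suc M) (λ t → α (M ∸ t) * (I j * E (M ∸ (M ∸ t))))
        ≈⟨ sumTo-cong (suc M) (λ t t<1+M →
             reflexive (≡.cong (λ r → α (M ∸ t) * (I j * E r)) (m∸[m∸n]≡n (≤-pred t<1+M)))) ⟩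
      sumTo K (suc M) (λ t → α (M ∸ t) * (I j * E t)) ∎
      where
      M : ℕ
      M = n ∸ j
      shifted : ∀ t → B (j ℕ.+ t) j * E (n ∸ (j ℕ.+ t)) ≈ α t * (I j * E (M ∸ t))
      shifted t = begin
        B (j ℕ.+ t) j * E (n ∸ (j ℕ.+ t))          ≈⟨ *-congʳ (bmul-constSer-eqX-≤ q α (m≤m+n j t)) ⟩
        α (j ℕ.+ t ∸ j) * I j * E (n ∸ (j ℕ.+ t))  ≡⟨ ≡.cong₂ (λ r s → α r * I j * E s)
                                                              (m+n∸m≡n j t) (≡.sym (∸-+-assoc n j t)) ⟩
        α t * I j * E (M ∸ t)                      ≈⟨ *-assoc _ _ _ ⟩
        α t * (I j * E (M ∸ t))                    ∎

    module _ (hq : ∀ (n : ℕ) → 1 ≤ n → ¬ (qnum K q n ≈ 0#)) where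

      Tapp-convolution : ∀ {n j} → j ≤ n →
               Tapp K q u y n (B n) j ≈ sumTo K (suc (n ∸ j)) (λ t → α (n ∸ j ∸ t) * (I j * E t))
      Tapp-convolution {n} {j} j≤n = begin
        Tapp K q u y n (B n) j
          ≈⟨ sumTo-from j≤n _ (λ m m<j → trans (*-congˡ (reflexive (Rcoef-> q u y m<j))) (zeroʳ _)) ⟩
        sumTo K (suc M) (λ t → B n (j ℕ.+ t) * Rcoef K q u y (j ℕ.+ t) j)
          ≈⟨ sumTo-cong (suc M) (λ t t<1+M → term t (≤-pred t<1+M)) ⟩
        sumTo K (suc M) (λ t → α (M ∸ t) * (I j * E t)) ∎
        where
        M : ℕ
        M = n ∸ j
        term : ∀ t → t ≤ M → B n (j ℕ.+ t) * Rcoef K q u y (j ℕ.+ t) j ≈ α (M ∸ t) * (I j * E t)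
        term t t≤M = begin
          B n (j ℕ.+ t) * Rcoef K q u y (j ℕ.+ t) j
            ≈⟨ *-congʳ (bmul-constSer-eqX-≤ q α j+t≤n) ⟩
          α (n ∸ (j ℕ.+ t)) * I (j ℕ.+ t) * Rcoef K q u y (j ℕ.+ t) j
            ≈⟨ *-assoc _ _ _ ⟩
          α (n ∸ (j ℕ.+ t)) * (I (j ℕ.+ t) * Rcoef K q u y (j ℕ.+ t) j)
            ≈⟨ *-congˡ (qinvfact-*-Rcoef q hq u y (m≤m+n j t)) ⟩
          α (n ∸ (j ℕ.+ t)) * (I j * E (j ℕ.+ t ∸ j))
            ≡⟨ ≡.cong₂ (λ r s → α r * (I j * E s)) (≡.sym (∸-+-assoc n j t)) (m+n∸m≡n j t) ⟩
          α (M ∸ t) * (I j * E t) ∎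
          where
          j+t≤n : j ℕ.+ t ≤ n
          j+t≤n = ≡.subst (j ℕ.+ t ≤_) (m+[n∸m]≡n j≤n) (+-monoʳ-≤ j t≤M)

      bmul-eqY≈Tapp : ∀ n j → bmul K B (eqY K q u y) n j ≈ Tapp K q u y n (B n) j
      bmul-eqY≈Tapp n j with j ≤? n
      ... | yes j≤n = trans (bmul-eqY-convolution j≤n) (sym (Tapp-convolution j≤n))
      ... | no j≰n =
        trans (bmul-constSerʳ B E n j) (trans (sumTo-zero (suc n) below) (sym (sumTo-zero (suc n) above)))
        where
        n<j : n < j
        n<j = ≰⇒> j≰n
        below : ∀ i → i < suc n → B i j * E (n ∸ i) ≈ 0#
        below i i<1+n = trans (*-congʳ (bmul-constSer-eqX-> q α (≤-<-trans (≤-pred i<1+n) n<j))) (zeroˡ _)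
        above : ∀ m → m < suc n → B n m * Rcoef K q u y m j ≈ 0#
        above m m<1+n = trans (*-congˡ (reflexive (Rcoef-> q u y (≤-<-trans (≤-pred m<1+n) n<j)))) (zeroʳ _)

theorem4 : ∀ {c ℓ : Level} (K : Field c ℓ) →
           let open Field K in
           (q u y : Carrier) →
           (∀ (n : ℕ) → 1 ≤ n → ¬ (qnum K q n ≈ 0#)) →
           (a : ℕ → Carrier) → ¬ (a 0 ≈ 0#) →
           (P₁ P₂ : ℕ → ℕ → Carrier) →
           (∀ n j → bmul K (Aser K q a) (eqX K q) n j ≈ genSer K q P₁ n j) →
           (∀ n j → bmul K (bmul K (Aser K q a) (eqX K q)) (eqY K q u y) n j
                      ≈ genSer K q P₂ n j) →
           ∀ n j → P₂ n j ≈ Tapp K q u y n (P₁ n) j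
-- a₀ ≉ 0 only makes the power A_q(t)^α meaningful; the identity holds for every series.
theorem4 K q u y hq a _ P₁ P₂ h₁ h₂ n j = begin
  P₂ n j                                         ≈⟨ genSer-coefficient K q hq h₂ n j ⟩
  qfact K q n * bmul K B (eqY K q u y) n j       ≈⟨ *-congˡ (bmul-eqY≈Tapp K q u y α hq n j) ⟩
  qfact K q n * Tapp K q u y n (B n) j           ≈⟨ *-distribˡ-Tapp K q u y n (qfact K q n) (B n) j ⟩
  Tapp K q u y n (λ m → qfact K q n * B n m) j   ≈⟨ Tapp-cong K q u y n (sym ∘ genSer-coefficient K q hq h₁ n) j ⟩
  Tapp K q u y n (P₁ n) j                        ∎
  where
  open Field K
  open import Relation.Binary.Reasoning.Setoid setoid
  α : ℕ → Carrier
  α i = a i * qinvfact K q i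
  B : BSer K
  B = bmul K (Aser K q a) (eqX K q)
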